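{- For any graph $G$ on $n$ vertices without isolated vertices, $Tr_t(G)\leq\min\{\Delta(G),\lfloor n/2\rfloor\}$, where $\Delta(G)$ is the maximum degree of $G$.
   Context: A total transitive partition of order $k$ of $G=(V,E)$ is a partition $\{V_1,\dots,V_k\}$ of $V$ into nonempty sets such that for all $1\leq i\leq j\leq k$, every vertex of $V_j$ has a neighbour in $V_i$ (for $i=j$: every vertex of $V_i$ is adjacent to another vertex of $V_i$). $Tr_t(G)$ is the maximum order of such a partition. -}

module Defs where

open import Data.Nat using (ℕ; _⊔_; _≤_)
open import Data.Fin using (Fin) renaming (_≤_ to _≤ᶠ_)
open import Data.List using (List; length; filter; foldr; map; allFin)
open import Data.Product using (∃; Σ; _×_; _,_)
open import Relation.Nullary using (¬_; Dec)
open import Relation.Binary.PropositionalEquality using (_≡_)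
open import Relation.Unary using (Decidable)
open import Level using (0ℓ)

record Graph (n : ℕ) : Set₁ where
  field
    Adj    : Fin n → Fin n → Set
    adj?   : ∀ u v → Dec (Adj u v)
    sym    : ∀ {u v} → Adj u v → Adj v u
    irrefl : ∀ {u} → ¬ Adj u u

module _ {n : ℕ} (G : Graph n) where
  open Graph G

  degree : Fin n → ℕ
  degree v = length (filter (adj? v) (allFin n))

  -- Δ(G) (0 for the empty graph)
  maxDegree : ℕ
  maxDegree = foldr _⊔_ 0 (map degree (allFin n))

  NoIsolatedVertices : Set
  NoIsolatedVertices = ∀ v → ∃ λ u → Adj v u

  -- A total transitive partition of order k, given as a class assignment
  -- c : V → Fin k (class V_{i+1} = c⁻¹(i)), all classes nonempty, and for
  -- every vertex v and every class index i ≤ c v, v has a neighbour in class i.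
  -- (For i = c v the neighbour is another vertex of the same class, by irreflexivity.)
  record TotalTransitivePartition (k : ℕ) : Set where
    field
      class    : Fin n → Fin k
      nonempty : ∀ (i : Fin k) → ∃ λ v → class v ≡ i
      total    : ∀ (v : Fin n) (i : Fin k) → i ≤ᶠ class v →
                 ∃ λ u → Adj v u × class u ≡ i

  -- Tr_t(G) ≤ m  :⇔  every total transitive partition has order ≤ m
  TrtAtMost : ℕ → Set
  TrtAtMost m = ∀ k → TotalTransitivePartition k → k ≤ m

{-# OPTIONS --safe #-}
-- In every class V_i pick a vertex a_i and a neighbour b_i of a_i inside V_i.
-- The 2k vertices a_i, b_i are pairwise distinct: two of them in different
-- classes differ, and a_i ≠ b_i because they are adjacent. Hence 2k ≤ n.
-- A vertex of the last class V_k has a neighbour in each of the k classes,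
-- and these neighbours lie in different classes, so k ≤ Δ(G).
module Submission where

open import Defs
open import Data.Empty using (⊥-elim)
open import Data.Fin using (Fin; fromℕ; splitAt; join) renaming (_≤_ to _≤ᶠ_)
open import Data.Fin.Properties using (injective⇒≤; ≤fromℕ; join-splitAt)
  renaming (≤-reflexive to ≤ᶠ-reflexive)
open import Data.List using (List; _∷_; length; foldr; lookup)
open import Data.List.Membership.Propositional using (_∈_)
open import Data.List.Membership.Propositional.Properties
  using (∈-filter⁺; ∈-allFin; ∈-map⁺)
open import Data.List.Relation.Unary.Any using (here; there; index)
open import Data.List.Relation.Unary.Any.Properties using (lookup-index)
open import Data.Nat using (ℕ; zero; suc; _⊓_; _/_; _⊔_; _≤_; _+_; _*_; z≤n)
open import Data.Nat.DivMod using (/-monoˡ-≤; m*n/n≡m)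
open import Data.Nat.Properties
  using (≤-trans; m≤m⊔n; m≤n⊔m; ⊓-glb; *-comm; +-identityʳ; module ≤-Reasoning)
open import Data.Product using (proj₁; proj₂)
open import Data.Sum using (_⊎_; inj₁; inj₂; [_,_])
open import Function.Base using (_∘_)
open import Function.Definitions using (Injective)
open import Relation.Binary.PropositionalEquality
  using (_≡_; _≢_; refl; sym; trans; cong; subst; module ≡-Reasoning)

injective⇒≤length : ∀ {A : Set} {k} {xs : List A} {f : Fin k → A} →
  Injective _≡_ _≡_ f → (∀ i → f i ∈ xs) → k ≤ length xs
injective⇒≤length {xs = xs} {f} f-injective f∈xs = injective⇒≤ position-injective
  where
  position-injective : Injective _≡_ _≡_ (λ i → index (f∈xs i))
  position-injective {i} {j} same-position = f-injective (begin
    f i                        ≡⟨ lookup-index (f∈xs i) ⟩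
    lookup xs (index (f∈xs i)) ≡⟨ cong (lookup xs) same-position ⟩
    lookup xs (index (f∈xs j)) ≡⟨ lookup-index (f∈xs j) ⟨
    f j                        ∎)
    where open ≡-Reasoning

retraction⇒injective : ∀ {A B : Set} {f : A → B} (g : B → A) →
  (∀ x → g (f x) ≡ x) → Injective _≡_ _≡_ f
retraction⇒injective {f = f} g g∘f≗id {x} {y} fx≡fy = begin
  x       ≡⟨ g∘f≗id x ⟨
  g (f x) ≡⟨ cong g fx≡fy ⟩
  g (f y) ≡⟨ g∘f≗id y ⟩
  y       ∎
  where open ≡-Reasoning

∈⇒≤foldr-⊔ : ∀ {x} {xs : List ℕ} → x ∈ xs → x ≤ foldr _⊔_ 0 xs
∈⇒≤foldr-⊔ {x} (here refl)            = m≤m⊔n x _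
∈⇒≤foldr-⊔ {xs = y ∷ _} (there x∈ys) = ≤-trans (∈⇒≤foldr-⊔ x∈ys) (m≤n⊔m y _)

m+m≤n⇒m≤n/2 : ∀ {m n} → m + m ≤ n → m ≤ n / 2
m+m≤n⇒m≤n/2 {m} {n} m+m≤n = begin
  m         ≡⟨ m*n/n≡m m 2 ⟨
  m * 2 / 2 ≤⟨ /-monoˡ-≤ 2 (subst (_≤ n) m+m≡m*2 m+m≤n) ⟩
  n / 2     ∎
  where
  open ≤-Reasoning
  m+m≡m*2 : m + m ≡ m * 2
  m+m≡m*2 = trans (cong (m +_) (sym (+-identityʳ m))) (*-comm 2 m)

module _ {n : ℕ} (G : Graph n) where
  open Graph G using (Adj; adj?; irrefl)

  degree≤maxDegree : ∀ v → degree G v ≤ maxDegree G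
  degree≤maxDegree v = ∈⇒≤foldr-⊔ (∈-map⁺ (degree G) (∈-allFin v))

  injective-neighbours⇒≤degree : ∀ {k} v {f : Fin k → Fin n} →
    Injective _≡_ _≡_ f → (∀ i → Adj v (f i)) → k ≤ degree G v
  injective-neighbours⇒≤degree v f-injective adjacent =
    injective⇒≤length f-injective (λ i → ∈-filter⁺ (adj? v) (∈-allFin _) (adjacent i))

  module _ {k : ℕ} (T : TotalTransitivePartition G k) where
    open TotalTransitivePartition T

    representative : Fin k → Fin n
    representative i = proj₁ (nonempty i)

    representative-class : ∀ i → class (representative i) ≡ i
    representative-class i = proj₂ (nonempty i)

    neighbourIn : ∀ v i → i ≤ᶠ class v → Fin n
    neighbourIn v i i≤cv = proj₁ (total v i i≤cv)

    neighbourIn-adjacent : ∀ v i i≤cv → Adj v (neighbourIn v i i≤cv)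
    neighbourIn-adjacent v i i≤cv = proj₁ (proj₂ (total v i i≤cv))

    neighbourIn-class : ∀ v i i≤cv → class (neighbourIn v i i≤cv) ≡ i
    neighbourIn-class v i i≤cv = proj₂ (proj₂ (total v i i≤cv))

    partner : Fin k → Fin n
    partner i = neighbourIn (representative i) i (≤ᶠ-reflexive (sym (representative-class i)))

    partner-adjacent : ∀ i → Adj (representative i) (partner i)
    partner-adjacent i = neighbourIn-adjacent (representative i) i _

    partner-class : ∀ i → class (partner i) ≡ i
    partner-class i = neighbourIn-class (representative i) i _

    representative≢partner : ∀ i j → representative i ≢ partner j
    representative≢partner i j eq
      with trans (sym (representative-class i)) (trans (cong class eq) (partner-class j))
    ... | refl = irrefl (subst (Adj (representative i)) (sym eq) (partner-adjacent i))

    representative-or-partner : Fin k ⊎ Fin k → Fin n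
    representative-or-partner = [ representative , partner ]

    representative-or-partner-injective : Injective _≡_ _≡_ representative-or-partner
    representative-or-partner-injective {inj₁ i} {inj₁ j} eq =
      cong inj₁ (retraction⇒injective class representative-class eq)
    representative-or-partner-injective {inj₂ i} {inj₂ j} eq =
      cong inj₂ (retraction⇒injective class partner-class eq)
    representative-or-partner-injective {inj₁ i} {inj₂ j} eq =
      ⊥-elim (representative≢partner i j eq)
    representative-or-partner-injective {inj₂ i} {inj₁ j} eq =
      ⊥-elim (representative≢partner j i (sym eq))

    order≤n/2 : k ≤ n / 2
    order≤n/2 = m+m≤n⇒m≤n/2 (injective⇒≤ {f = representative-or-partner ∘ splitAt k}
      (splitAt-injective ∘ representative-or-partner-injective))
      where
      splitAt-injective : Injective _≡_ _≡_ (splitAt k {k})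
      splitAt-injective = retraction⇒injective (join k k) (join-splitAt k k)

    top-class⇒order≤degree : ∀ v → (∀ i → i ≤ᶠ class v) → k ≤ degree G v
    top-class⇒order≤degree v top = injective-neighbours⇒≤degree v
      (retraction⇒injective class (λ i → neighbourIn-class v i (top i)))
      (λ i → neighbourIn-adjacent v i (top i))

  order≤maxDegree : ∀ {k} → TotalTransitivePartition G k → k ≤ maxDegree G
  order≤maxDegree {zero}  _ = z≤n
  order≤maxDegree {suc k} T = ≤-trans (top-class⇒order≤degree T v v-top) (degree≤maxDegree v)
    where
    v : Fin n
    v = representative T (fromℕ k)
    v-top : ∀ i → i ≤ᶠ TotalTransitivePartition.class T v
    v-top i = subst (i ≤ᶠ_) (sym (representative-class T (fromℕ k))) (≤fromℕ i)

proposition1 : ∀ (n : ℕ) (G : Graph n) → NoIsolatedVertices G →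
    TrtAtMost G (maxDegree G ⊓ (n / 2))
proposition1 n G _ k T = ⊓-glb (order≤maxDegree G T) (order≤n/2 G T)
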